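{- For every $n\ge 1$ there is a bijection $\Omega_n:\mathcal{Q}_n\to\mathcal{Q}_n$ such that $\mathrm{des}(\pi)=\mathrm{asc}(\Omega_n(\pi))$ for all $\pi\in\mathcal{Q}_n$.
   Context: Permutations of $[n]=\{1,\dots,n\}$ are written as words $\pi(1)\cdots\pi(n)$. $\mathrm{des}(\pi)$ (resp. $\mathrm{asc}(\pi)$) is the number of indices $i\in[n-1]$ with $\pi(i)>\pi(i+1)$ (resp. $\pi(i)<\pi(i+1)$). $\mathcal{Q}_n$ denotes the set of permutations $\pi$ of $[n]$ such that $\pi(1)<\pi(2)<\cdots<\pi(p)$ where $p=\pi^{ -1}(n)$ (i.e. $n$ is the top of the first descent; the identity permutation is included). -}

module Defs where

open import Data.Nat using (ℕ; zero; suc; _<_; _≤_)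
open import Data.Fin using (Fin; toℕ; inject₁; fromℕ)
import Data.Fin as F
open import Data.Vec using (Vec; lookup; toList)
open import Data.List.Relation.Unary.Unique.Propositional using (Unique)
open import Data.Product using (Σ; _×_; _,_)
open import Data.List using (length; filter)
open import Data.List using (allFin)
open import Relation.Nullary using (Dec)
import Data.Nat as N
open import Relation.Binary.PropositionalEquality using (_≡_)

-- A permutation of [n] in one-line notation: a word w(0) ... w(n-1) over Fin n
-- with no repeated letter (hence a bijection Fin n → Fin n). Letter k : Fin n
-- stands for the value k+1 of [n]; position i : Fin n stands for i+1.
IsPerm : ∀ {n} → Vec (Fin n) n → Set
IsPerm w = Unique (toList w)

des : ∀ {m} → Vec (Fin (suc m)) (suc m) → ℕ
des {m} w = length (filter (λ i → toℕ (lookup w (F.suc i)) N.<? toℕ (lookup w (inject₁ i))) (allFin m))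

asc : ∀ {m} → Vec (Fin (suc m)) (suc m) → ℕ
asc {m} w = length (filter (λ i → toℕ (lookup w (inject₁ i)) N.<? toℕ (lookup w (F.suc i))) (allFin m))

-- Q_n : permutations increasing up to the position p of the maximum letter n
-- (fromℕ m is the largest letter of Fin (suc m)): for every i with i+1 ≤ p
-- (0-based positions), w(i) < w(i+1).
InQ : ∀ {m} → Vec (Fin (suc m)) (suc m) → Set
InQ {m} w = IsPerm w ×
  ((i : Fin m) → (p : Fin (suc m)) → lookup w p ≡ fromℕ m →
     toℕ (F.suc i) ≤ toℕ p → toℕ (lookup w (inject₁ i)) < toℕ (lookup w (F.suc i)))

{-# OPTIONS --safe #-}
-- Split a permutation at its minimum a as u a v. Then des (u a v) = des u + [u ≠ ∅] + des v and
-- asc (u a v) = asc u + [v ≠ ∅] + asc v. So recursively transform u and v and, when exactly one of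
-- them is empty, move it to the other side of a: this is an involution turning descents into ascents.
-- It preserves Q_n: as the prefix ending at n is increasing, n can follow a only when u is empty;
-- either way n lies in the side placed left of a, where induction applies.
module Submission where

open import Defs
open import Data.Nat using (ℕ; zero; suc; pred; _+_; _⊓_; _≤_; z≤n; s≤s; s≤s⁻¹)
open import Data.Nat.Properties
  using (+-assoc; +-comm; +-suc; +-identityʳ; ≤-trans; ≤-reflexive; <⇒≤; ≰⇒>; <⇒≱; m≤m+n; m≤n+m)
open import Data.Fin using (Fin; toℕ; inject₁; fromℕ; _<_; _<?_)
import Data.Fin as F
open import Data.Fin.Properties using (<-asym; ≤∧≢⇒<; ≤fromℕ)
open import Data.Vec using (Vec; lookup; toList; fromList; cast)
import Data.Vec as V
open import Data.Vec.Properties using (toList∘fromList; toList-injective; cast-is-id; length-toList)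
open import Data.Vec.Membership.Propositional.Properties using (∈-lookup; ∈-toList⁺; ∈-toList⁻)
open import Data.Vec.Relation.Unary.Any using (index)
open import Data.Vec.Relation.Unary.Any.Properties using (lookup-index)
open import Data.List using (List; []; _∷_; _++_; _∷ʳ_; length; filter; tabulate; allFin)
open import Data.List.Properties using (length-++)
open import Data.List.Relation.Unary.All using (All; []; _∷_)
import Data.List.Relation.Unary.All as All
import Data.List.Relation.Unary.All.Properties as Allₚ
open import Data.List.Relation.Unary.Any using (here; there)
open import Data.List.Relation.Unary.AllPairs using ([]; _∷_)
import Data.List.Relation.Unary.AllPairs as AllPairs
open import Data.List.Relation.Unary.Unique.Propositional using (Unique)
open import Data.List.Relation.Unary.Unique.Propositional.Properties using (Unique[x∷xs]⇒x∉xs)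
open import Data.List.Membership.Propositional using (_∈_; _∉_)
open import Data.List.Membership.Propositional.Properties using (∈-++⁺ˡ; ∈-++⁻)
open import Data.List.Relation.Binary.Permutation.Propositional
  using (_↭_; ↭-refl; ↭-reflexive; ↭-prep; ↭-sym; ↭-trans; ↭⇒↭ₛ)
open import Data.List.Relation.Binary.Permutation.Propositional.Properties
  using (All-resp-↭; ∈-resp-↭; ↭-length; ++⁺; ∷↭∷ʳ)
import Data.List.Relation.Binary.Permutation.Setoid.Properties as PermutationₛProperties
open import Data.Product using (Σ; _×_; _,_; proj₁; proj₂)
open import Data.Sum using ([_,_])
open import Data.Bool using (true; false; if_then_else_)
open import Data.Unit using (⊤; tt)
open import Function using (_∘_)
open import Level using (0ℓ)
open import Relation.Nullary using (¬_; yes; no; does; contradiction)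
open import Relation.Nullary.Decidable using (dec-true; dec-false)
open import Relation.Unary using (Pred) renaming (Decidable to Decidable₁)
open import Relation.Binary using (Rel; Decidable)
open import Relation.Binary.PropositionalEquality using (_≡_; refl; setoid; sym; trans; cong; cong₂; subst; module ≡-Reasoning)
open ≡-Reasoning

private
  variable
    k : ℕ

nonEmpty : {A : Set} → List A → ℕ
nonEmpty l = 1 ⊓ length l

-- Counting adjacent pairs

module _ {A : Set} {R : Rel A 0ℓ} (R? : Decidable R) where

  countAdjacent : List A → ℕ
  countAdjacent []          = 0
  countAdjacent (x ∷ [])    = 0
  countAdjacent (x ∷ y ∷ l) = (if does (R? x y) then 1 else 0) + countAdjacent (y ∷ l)

  countAdjacent-++-∷ : ∀ p x q → countAdjacent (p ++ x ∷ q) ≡ countAdjacent (p ∷ʳ x) + countAdjacent (x ∷ q)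
  countAdjacent-++-∷ []           x q = refl
  countAdjacent-++-∷ (z ∷ [])     x q = cong (_+ countAdjacent (x ∷ q)) (sym (+-identityʳ _))
  countAdjacent-++-∷ (z ∷ y ∷ p) x q = begin
    b + countAdjacent (y ∷ p ++ x ∷ q)                      ≡⟨ cong (b +_) (countAdjacent-++-∷ (y ∷ p) x q) ⟩
    b + (countAdjacent (y ∷ p ∷ʳ x) + countAdjacent (x ∷ q)) ≡⟨ sym (+-assoc b _ _) ⟩
    b + countAdjacent (y ∷ p ∷ʳ x) + countAdjacent (x ∷ q)   ∎
    where b = if does (R? z y) then 1 else 0

  countAdjacent-∷-related : ∀ {x} q → All (R x) q → countAdjacent (x ∷ q) ≡ nonEmpty q + countAdjacent q
  countAdjacent-∷-related []      []        = refl
  countAdjacent-∷-related {x} (y ∷ q) (r ∷ _) rewrite dec-true (R? x y) r = refl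

  countAdjacent-∷-unrelated : ∀ {x} q → All (¬_ ∘ R x) q → countAdjacent (x ∷ q) ≡ countAdjacent q
  countAdjacent-∷-unrelated []      []        = refl
  countAdjacent-∷-unrelated {x} (y ∷ q) (¬r ∷ _) rewrite dec-false (R? x y) ¬r = refl

  countAdjacent-∷ʳ-related : ∀ {x} p → All (λ z → R z x) p → countAdjacent (p ∷ʳ x) ≡ countAdjacent p + nonEmpty p
  countAdjacent-∷ʳ-related []          []       = refl
  countAdjacent-∷ʳ-related {x} (z ∷ []) (r ∷ _) rewrite dec-true (R? z x) r = refl
  countAdjacent-∷ʳ-related {x} (z ∷ y ∷ p) (_ ∷ rs) =
    trans (cong (b +_) (countAdjacent-∷ʳ-related (y ∷ p) rs)) (sym (+-assoc b _ 1))
    where b = if does (R? z y) then 1 else 0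

  countAdjacent-∷ʳ-unrelated : ∀ {x} p → All (λ z → ¬ R z x) p → countAdjacent (p ∷ʳ x) ≡ countAdjacent p
  countAdjacent-∷ʳ-unrelated []          []        = refl
  countAdjacent-∷ʳ-unrelated {x} (z ∷ []) (¬r ∷ _) rewrite dec-false (R? z x) ¬r = refl
  countAdjacent-∷ʳ-unrelated (z ∷ y ∷ p) (_ ∷ rs) =
    cong ((if does (R? z y) then 1 else 0) +_) (countAdjacent-∷ʳ-unrelated (y ∷ p) rs)

descents ascents : List (Fin k) → ℕ
descents = countAdjacent (λ x y → y <? x)
ascents  = countAdjacent _<?_

descents-++-∷-min : ∀ p (a : Fin k) q → All (a <_) p → All (a <_) q →
                    descents (p ++ a ∷ q) ≡ descents p + nonEmpty p + descents q
descents-++-∷-min p a q a<p a<q = begin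
  descents (p ++ a ∷ q)                     ≡⟨ countAdjacent-++-∷ _ p a q ⟩
  descents (p ∷ʳ a) + descents (a ∷ q)      ≡⟨ cong₂ _+_ (countAdjacent-∷ʳ-related _ p a<p)
                                                          (countAdjacent-∷-unrelated _ q (All.map <-asym a<q)) ⟩
  descents p + nonEmpty p + descents q      ∎

ascents-++-∷-min : ∀ p (a : Fin k) q → All (a <_) p → All (a <_) q →
                   ascents (p ++ a ∷ q) ≡ ascents p + nonEmpty q + ascents q
ascents-++-∷-min p a q a<p a<q = begin
  ascents (p ++ a ∷ q)                      ≡⟨ countAdjacent-++-∷ _ p a q ⟩
  ascents (p ∷ʳ a) + ascents (a ∷ q)        ≡⟨ cong₂ _+_ (countAdjacent-∷ʳ-unrelated _ p (All.map <-asym a<p))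
                                                          (countAdjacent-∷-related _ q a<q) ⟩
  ascents p + (nonEmpty q + ascents q)      ≡⟨ sym (+-assoc (ascents p) _ _) ⟩
  ascents p + nonEmpty q + ascents q        ∎

-- Splitting at the minimum

record Split (A : Set) : Set where
  constructor split
  field
    left  : List A
    pivot : A
    right : List A

join : {A : Set} → Split A → List A
join (split u a v) = u ++ a ∷ v

mapSides : {A : Set} → (List A → List A) → Split A → Split A
mapSides f (split u a v) = split (f u) a (f v)

IsMinSplit : Split (Fin k) → Set
IsMinSplit (split u a v) = All (a <_) u × All (a <_) v

splitMin : Fin k → List (Fin k) → Split (Fin k)
splitMin x [] = split [] x []
splitMin x (y ∷ ys) with splitMin y ys
... | split u m v with x F.≤? m
...   | yes _ = split [] x (y ∷ ys)
...   | no  _ = split (x ∷ u) m v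

splitMin-join : (x : Fin k) (xs : List (Fin k)) → join (splitMin x xs) ≡ x ∷ xs
splitMin-join x [] = refl
splitMin-join x (y ∷ ys) with splitMin y ys | splitMin-join y ys
... | split u m v | eq with x F.≤? m
...   | yes _ = refl
...   | no  _ = cong (x ∷_) eq

splitMin-min : (x : Fin k) (xs : List (Fin k)) →
               let (split u a v) = splitMin x xs in All (a <_) u × All (a F.≤_) v
splitMin-min x [] = [] , []
splitMin-min x (y ∷ ys) with splitMin y ys | splitMin-join y ys | splitMin-min y ys
... | split u m v | eq | m<u , m≤v with x F.≤? m
...   | yes x≤m = [] , subst (All (x F.≤_)) eq (Allₚ.++⁺ (All.map (λ m<z → ≤-trans x≤m (<⇒≤ m<z)) m<u)
                                                  (x≤m ∷ All.map (≤-trans x≤m) m≤v))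
...   | no  x≰m = ≰⇒> x≰m ∷ m<u , m≤v

splitMin-least : (a : Fin k) (q : List (Fin k)) → All (a <_) q → splitMin a q ≡ split [] a q
splitMin-least a [] _ = refl
splitMin-least a (y ∷ ys) a<q with splitMin y ys | splitMin-join y ys
... | split u m v | eq with a F.≤? m
...   | yes _   = refl
...   | no  a≰m = contradiction (<⇒≤ a<m) a≰m
  where a<m = All.head (Allₚ.++⁻ʳ u (subst (All (a <_)) (sym eq) a<q))

splitMin-++ : (a z : Fin k) (p q : List (Fin k)) → IsMinSplit (split (z ∷ p) a q) →
              splitMin z (p ++ a ∷ q) ≡ split (z ∷ p) a q
splitMin-++ a z [] q (a<z ∷ [] , a<q) rewrite splitMin-least a q a<q with z F.≤? a
... | yes z≤a = contradiction z≤a (<⇒≱ a<z)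
... | no  _   = refl
splitMin-++ a z (y ∷ p) q (a<z ∷ a<p , a<q) rewrite splitMin-++ a y p q (a<p , a<q) with z F.≤? a
... | yes z≤a = contradiction z≤a (<⇒≱ a<z)
... | no  _   = refl

-- The involution ω

exchange : {A : Set} → Split A → Split A
exchange (split []      a v)       = split v a []
exchange (split (z ∷ u) a [])      = split [] a (z ∷ u)
exchange (split (z ∷ u) a (y ∷ v)) = split (z ∷ u) a (y ∷ v)

-- The first argument is fuel: ω n l is the intended value as soon as length l ≤ n.
ω : ℕ → List (Fin k) → List (Fin k)
ω zero    l        = l
ω (suc n) []       = []
ω (suc n) (x ∷ xs) = join (mapSides (ω n) (exchange (splitMin x xs)))

exchange-involutive : {A : Set} (t : Split A) → exchange (exchange t) ≡ t
exchange-involutive (split []      a [])      = refl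
exchange-involutive (split []      a (y ∷ v)) = refl
exchange-involutive (split (z ∷ u) a [])      = refl
exchange-involutive (split (z ∷ u) a (y ∷ v)) = refl

exchange-join-↭ : {A : Set} (t : Split A) → join (exchange t) ↭ join t
exchange-join-↭ (split []      a v)       = ↭-sym (∷↭∷ʳ a v)
exchange-join-↭ (split (z ∷ u) a [])      = ∷↭∷ʳ a (z ∷ u)
exchange-join-↭ (split (z ∷ u) a (y ∷ v)) = ↭-refl

exchange-IsMinSplit : (t : Split (Fin k)) → IsMinSplit t → IsMinSplit (exchange t)
exchange-IsMinSplit (split []      a v)       (a<u , a<v) = a<v , a<u
exchange-IsMinSplit (split (z ∷ u) a [])      (a<u , a<v) = a<v , a<u
exchange-IsMinSplit (split (z ∷ u) a (y ∷ v)) a<t         = a<t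

exchange-mapSides : {A : Set} (f : List A → List A) → (∀ l → length (f l) ≡ length l) →
                    (t : Split A) → exchange (mapSides f t) ≡ mapSides f (exchange t)
exchange-mapSides f len (split [] a v) with f [] | len []
... | [] | _ = refl
exchange-mapSides f len (split (z ∷ u) a []) with f [] | len [] | f (z ∷ u) | len (z ∷ u)
... | [] | _ | _ ∷ _ | _ = refl
exchange-mapSides f len (split (z ∷ u) a (y ∷ v)) with f (z ∷ u) | len (z ∷ u) | f (y ∷ v) | len (y ∷ v)
... | _ ∷ _ | _ | _ ∷ _ | _ = refl

exchange-statistic : {A : Set} (s : List A → ℕ) → s [] ≡ 0 → (t : Split A) →
                     let (split u _ v) = t ; (split u′ _ v′) = exchange t in
                     s u′ + nonEmpty v′ + s v′ ≡ s u + nonEmpty u + s v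
exchange-statistic s s[]≡0 (split [] a v) rewrite s[]≡0 =
  trans (+-identityʳ _) (+-identityʳ _)
exchange-statistic s s[]≡0 (split (z ∷ u) a []) rewrite s[]≡0 =
  trans (+-comm 1 _) (sym (+-identityʳ _))
exchange-statistic s s[]≡0 (split (z ∷ u) a (y ∷ v)) = refl

join-mapSides-↭ : {A : Set} {f : List A → List A} → (∀ l → f l ↭ l) → (t : Split A) → join (mapSides f t) ↭ join t
join-mapSides-↭ f↭ (split u a v) = ++⁺ (f↭ u) (↭-prep a (f↭ v))

ω-[] : ∀ n → ω {k} n [] ≡ []
ω-[] zero    = refl
ω-[] (suc n) = refl

ω-↭ : ∀ n (l : List (Fin k)) → ω n l ↭ l
ω-↭ zero    l        = ↭-refl
ω-↭ (suc n) []       = ↭-refl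
ω-↭ (suc n) (x ∷ xs) = ↭-trans (join-mapSides-↭ (ω-↭ n) (exchange s))
                         (↭-trans (exchange-join-↭ s) (↭-reflexive (splitMin-join x xs)))
  where s = splitMin x xs

ω-length : ∀ n (l : List (Fin k)) → length (ω n l) ≡ length l
ω-length n l = ↭-length (ω-↭ n l)

ω-All : ∀ {P : Pred (Fin k) 0ℓ} n {l} → All P l → All P (ω n l)
ω-All n {l} = All-resp-↭ (↭-sym (ω-↭ n l))

ω-IsMinSplit : ∀ n (t : Split (Fin k)) → IsMinSplit t → IsMinSplit (mapSides (ω n) t)
ω-IsMinSplit n (split u a v) (a<u , a<v) = ω-All n a<u , ω-All n a<v

ω-join : ∀ n (t : Split (Fin k)) → IsMinSplit t → ω (suc n) (join t) ≡ join (mapSides (ω n) (exchange t))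
ω-join n (split []      a v) (_ , a<v) rewrite splitMin-least a v a<v = refl
ω-join n (split (z ∷ u) a v) min-t     rewrite splitMin-++ a z u v min-t = refl

Unique-++⁻ : {A : Set} (xs : List A) {ys : List A} → Unique (xs ++ ys) → Unique xs × Unique ys
Unique-++⁻ []       u          = [] , u
Unique-++⁻ (x ∷ xs) (x∉ ∷ u) = let (uxs , uys) = Unique-++⁻ xs u in Allₚ.++⁻ˡ xs x∉ ∷ uxs , uys

length-++-∷-≤ : {A : Set} (u : List A) (a : A) (v : List A) {n : ℕ} →
                length (u ++ a ∷ v) ≤ suc n → length u ≤ n × length v ≤ n
length-++-∷-≤ u a v {n} len≤ = ≤-trans (m≤m+n _ _) u+v≤n , ≤-trans (m≤n+m _ _) u+v≤n
  where
    u+v≤n : length u + length v ≤ n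
    u+v≤n = s≤s⁻¹ (subst (_≤ suc n) (trans (length-++ u) (+-suc (length u) (length v))) len≤)

splitMin-IsMinSplit : (x : Fin k) (xs : List (Fin k)) → Unique (x ∷ xs) → IsMinSplit (splitMin x xs)
splitMin-IsMinSplit x xs uniq with splitMin x xs | splitMin-join x xs | splitMin-min x xs
... | split u a v | eq | a<u , a≤v = a<u , All.zipWith (λ (a≤ , a≢) → ≤∧≢⇒< a≤ a≢) (a≤v , a≢v)
  where
    a≢v = Allₚ.¬Any⇒All¬ v (Unique[x∷xs]⇒x∉xs (proj₂ (Unique-++⁻ u (subst Unique (sym eq) uniq))))

minSplit-induction : (P : ℕ → List (Fin k) → Set) → (∀ n → P n []) →
                     (∀ n u a v → IsMinSplit (split u a v) → P n u → P n v → P (suc n) (u ++ a ∷ v)) →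
                     ∀ n l → length l ≤ n → Unique l → P n l
minSplit-induction P base step zero    []       _    _    = base zero
minSplit-induction P base step (suc n) []       _    _    = base (suc n)
minSplit-induction P base step (suc n) (x ∷ xs) len≤ uniq
  with splitMin x xs | splitMin-join x xs | splitMin-IsMinSplit x xs uniq
... | split u a v | eq | min-t =
  let (u≤ , v≤)          = length-++-∷-≤ u a v (subst (λ l → length l ≤ suc n) (sym eq) len≤)
      (uniq-u , uniq-av) = Unique-++⁻ u (subst Unique (sym eq) uniq)
  in subst (P (suc n)) eq (step n u a v min-t (minSplit-induction P base step n u u≤ uniq-u)
                                            (minSplit-induction P base step n v v≤ (AllPairs.tail uniq-av)))

ω-involutive : ∀ n (l : List (Fin k)) → length l ≤ n → Unique l → ω n (ω n l) ≡ l
ω-involutive = minSplit-induction (λ n l → ω n (ω n l) ≡ l) base step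
  where
    base : ∀ n → ω n (ω {k} n []) ≡ []
    base n = trans (cong (ω n) (ω-[] n)) (ω-[] n)

    step : ∀ n u a v → IsMinSplit (split u a v) → ω n (ω n u) ≡ u → ω n (ω n v) ≡ v →
           ω (suc n) (ω (suc n) (u ++ a ∷ v)) ≡ u ++ a ∷ v
    step n u a v min-t ωωu ωωv = begin
      ω (suc n) (ω (suc n) (join t))                                  ≡⟨ cong (ω (suc n)) (ω-join n t min-t) ⟩
      ω (suc n) (join (mapSides (ω n) (exchange t)))                  ≡⟨ ω-join n _ (ω-IsMinSplit n _ (exchange-IsMinSplit t min-t)) ⟩
      join (mapSides (ω n) (exchange (mapSides (ω n) (exchange t)))) ≡⟨ cong (join ∘ mapSides (ω n))
                                                                            (exchange-mapSides (ω n) (ω-length n) (exchange t)) ⟩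
      join (mapSides (ω n) (mapSides (ω n) (exchange (exchange t))))  ≡⟨ cong (join ∘ mapSides (ω n) ∘ mapSides (ω n))
                                                                            (exchange-involutive t) ⟩
      ω n (ω n u) ++ a ∷ ω n (ω n v)                                  ≡⟨ cong₂ (λ p q → p ++ a ∷ q) ωωu ωωv ⟩
      u ++ a ∷ v                                                      ∎
      where t = split u a v

ascents-ω : ∀ n (l : List (Fin k)) → length l ≤ n → Unique l → ascents (ω n l) ≡ descents l
ascents-ω = minSplit-induction (λ n l → ascents (ω n l) ≡ descents l) base step
  where
    base : ∀ n → ascents (ω {k} n []) ≡ 0
    base n = cong ascents (ω-[] n)

    step : ∀ n u a v → IsMinSplit (split u a v) →
           ascents (ω n u) ≡ descents u → ascents (ω n v) ≡ descents v →
           ascents (ω (suc n) (u ++ a ∷ v)) ≡ descents (u ++ a ∷ v)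
    step n u a v min-t@(a<u , a<v) asc-u asc-v = begin
      ascents (ω (suc n) (join t))                               ≡⟨ cong ascents (ω-join n t min-t) ⟩
      ascents (ω n u′ ++ a′ ∷ ω n v′)                            ≡⟨ ascents-++-∷-min _ a′ _ a′<ωu′ a′<ωv′ ⟩
      ascents (ω n u′) + nonEmpty (ω n v′) + ascents (ω n v′)    ≡⟨ cong (λ e → ascents (ω n u′) + e + ascents (ω n v′))
                                                                       (cong (1 ⊓_) (ω-length n v′)) ⟩
      ascents (ω n u′) + nonEmpty v′ + ascents (ω n v′)          ≡⟨ exchange-statistic (ascents ∘ ω n) (base n) t ⟩
      ascents (ω n u) + nonEmpty u + ascents (ω n v)             ≡⟨ cong₂ (λ p q → p + nonEmpty u + q) asc-u asc-v ⟩
      descents u + nonEmpty u + descents v                       ≡⟨ sym (descents-++-∷-min u a v a<u a<v) ⟩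
      descents (u ++ a ∷ v)                                      ∎
      where
        t = split u a v
        open Split (exchange t) renaming (left to u′; pivot to a′; right to v′)
        a′<ωu′ = proj₁ (ω-IsMinSplit n _ (exchange-IsMinSplit t min-t))
        a′<ωv′ = proj₂ (ω-IsMinSplit n _ (exchange-IsMinSplit t min-t))

-- The prefix ending at the maximum

IncreasingTo : Fin k → List (Fin k) → Set
IncreasingTo M []          = ⊤
IncreasingTo M (x ∷ [])    = ⊤
IncreasingTo M (x ∷ y ∷ l) = (M ∈ y ∷ l → x < y) × IncreasingTo M (y ∷ l)

module _ {M : Fin k} where

  IncreasingTo-++⁻ˡ : ∀ p q → IncreasingTo M (p ++ q) → IncreasingTo M p
  IncreasingTo-++⁻ˡ []          q _           = tt
  IncreasingTo-++⁻ˡ (x ∷ [])    q _           = tt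
  IncreasingTo-++⁻ˡ (x ∷ y ∷ p) q (x<y , inc) = x<y ∘ ∈-++⁺ˡ , IncreasingTo-++⁻ˡ (y ∷ p) q inc

  IncreasingTo-∷-∉ : ∀ x l → M ∉ l → IncreasingTo M (x ∷ l)
  IncreasingTo-∷-∉ x []      _   = tt
  IncreasingTo-∷-∉ x (y ∷ l) M∉l = (λ M∈l → contradiction M∈l M∉l) , IncreasingTo-∷-∉ y l (M∉l ∘ there)

  IncreasingTo-++⁺ : ∀ p q → M ∉ q → IncreasingTo M p → IncreasingTo M (p ++ q)
  IncreasingTo-++⁺ []          []      _   _           = tt
  IncreasingTo-++⁺ []          (y ∷ q) M∉q _           = IncreasingTo-∷-∉ y q (M∉q ∘ there)
  IncreasingTo-++⁺ (x ∷ [])    q       M∉q _           = IncreasingTo-∷-∉ x q M∉q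
  IncreasingTo-++⁺ (x ∷ y ∷ p) q       M∉q (x<y , inc) =
    [ x<y , (λ M∈q → contradiction M∈q M∉q) ] ∘ ∈-++⁻ (y ∷ p) , IncreasingTo-++⁺ (y ∷ p) q M∉q inc

  IncreasingTo-∷-min : ∀ {a} q → All (a <_) q → IncreasingTo M q → IncreasingTo M (a ∷ q)
  IncreasingTo-∷-min []      _         _   = tt
  IncreasingTo-∷-min (y ∷ q) (a<y ∷ _) inc = (λ _ → a<y) , inc

  -- The descent into the pivot cannot precede M.
  IncreasingTo-∉-from-min : ∀ {a} z p q → All (a <_) (z ∷ p) → IncreasingTo M (z ∷ p ++ a ∷ q) → M ∉ a ∷ q
  IncreasingTo-∉-from-min z []      q (a<z ∷ _) (z<a , _) M∈ = <-asym a<z (z<a M∈)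
  IncreasingTo-∉-from-min z (y ∷ p) q (_ ∷ a<p) (_ , inc)  = IncreasingTo-∉-from-min y p q a<p inc

  private
    Preserved : ℕ → List (Fin k) → Set
    Preserved n l = All (F._≤ M) l → IncreasingTo M l → IncreasingTo M (ω n l)

  IncreasingTo-ω : ∀ n l → length l ≤ n → Unique l → All (F._≤ M) l → IncreasingTo M l → IncreasingTo M (ω n l)
  IncreasingTo-ω = minSplit-induction Preserved base step
    where
      base : ∀ n → Preserved n []
      base n _ _ rewrite ω-[] {k} n = tt

      step : ∀ n u a v → IsMinSplit (split u a v) → Preserved n u → Preserved n v → Preserved (suc n) (u ++ a ∷ v)
      step n u a v min-t pres-u pres-v bounded inc rewrite ω-join n (split u a v) min-t = glued u v min-t pres-u pres-v bounded inc
        where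
          glued : ∀ u v → IsMinSplit (split u a v) → Preserved n u → Preserved n v →
                  All (F._≤ M) (u ++ a ∷ v) → IncreasingTo M (u ++ a ∷ v) →
                  IncreasingTo M (join (mapSides (ω n) (exchange (split u a v))))
          glued []      []      _           _      _      _              _         rewrite ω-[] {k} n = tt
          glued []      (y ∷ v) (_ , a<y ∷ _) _    pres-v (_ ∷ y≤M ∷ v≤M) (_ , inc) rewrite ω-[] {k} n =
            IncreasingTo-++⁺ (ω n (y ∷ v)) (a ∷ []) M∉[a] (pres-v (y≤M ∷ v≤M) inc)
            where
              M∉[a] : M ∉ a ∷ []
              M∉[a] (here refl) = <⇒≱ a<y y≤M
          glued (z ∷ u) []      (a<u , _)   pres-u _      ≤M             inc rewrite ω-[] {k} n =
            IncreasingTo-∷-min (ω n (z ∷ u)) (ω-All n a<u)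
              (pres-u (Allₚ.++⁻ˡ (z ∷ u) ≤M) (IncreasingTo-++⁻ˡ (z ∷ u) (a ∷ []) inc))
          glued (z ∷ u) (y ∷ v) (a<u , _)   pres-u _      ≤M             inc =
            IncreasingTo-++⁺ (ω n (z ∷ u)) (a ∷ ω n (y ∷ v)) (M∉ ∘ ∈-resp-↭ (↭-prep a (ω-↭ n (y ∷ v))))
              (pres-u (Allₚ.++⁻ˡ (z ∷ u) ≤M) (IncreasingTo-++⁻ˡ (z ∷ u) (a ∷ y ∷ v) inc))
            where M∉ = IncreasingTo-∉-from-min z u (y ∷ v) a<u inc

-- Permutations as vectors

length-filter-∷ : {A : Set} {P : Pred A 0ℓ} (P? : Decidable₁ P) (x : A) (xs : List A) →
                  length (filter P? (x ∷ xs)) ≡ (if does (P? x) then 1 else 0) + length (filter P? xs)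
length-filter-∷ P? x xs with does (P? x)
... | true  = refl
... | false = refl

length-filter-tabulate : {A : Set} {P : Pred A 0ℓ} (P? : Decidable₁ P) {n : ℕ} (f : Fin n → A) →
                         length (filter P? (tabulate f)) ≡ length (filter (P? ∘ f) (allFin n))
length-filter-tabulate P? {zero}  f = refl
length-filter-tabulate P? {suc n} f = begin
  length (filter P? (tabulate f))                      ≡⟨ length-filter-∷ P? (f F.zero) _ ⟩
  b + length (filter P? (tabulate (f ∘ F.suc)))        ≡⟨ cong (b +_) (length-filter-tabulate P? (f ∘ F.suc)) ⟩
  b + length (filter (P? ∘ f ∘ F.suc) (allFin n))      ≡⟨ cong (b +_) (sym (length-filter-tabulate (P? ∘ f) F.suc)) ⟩
  b + length (filter (P? ∘ f) (tabulate F.suc))        ≡⟨ sym (length-filter-∷ (P? ∘ f) F.zero _) ⟩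
  length (filter (P? ∘ f) (allFin (suc n)))            ∎
  where b = if does (P? (f F.zero)) then 1 else 0

countAdjacent-lookup : {A : Set} {R : Rel A 0ℓ} (R? : Decidable R) {m : ℕ} (w : Vec A (suc m)) →
                       length (filter (λ i → R? (lookup w (inject₁ i)) (lookup w (F.suc i))) (allFin m))
                       ≡ countAdjacent R? (toList w)
countAdjacent-lookup R? {zero}  (x V.∷ V.[])    = refl
countAdjacent-lookup R? {suc m} (x V.∷ y V.∷ w) =
  trans (length-filter-∷ adjacent? F.zero _)
        (cong (_ +_) (trans (length-filter-tabulate adjacent? F.suc) (countAdjacent-lookup R? (y V.∷ w))))
  where adjacent? = λ i → R? (lookup (x V.∷ y V.∷ w) (inject₁ i)) (lookup (x V.∷ y V.∷ w) (F.suc i))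

IncreasingToᵛ : {n : ℕ} → Fin k → Vec (Fin k) (suc n) → Set
IncreasingToᵛ {n = n} M w = (i : Fin n) (p : Fin (suc n)) → lookup w p ≡ M →
                            toℕ (F.suc i) ≤ toℕ p → lookup w (inject₁ i) < lookup w (F.suc i)

IncreasingToᵛ⇒IncreasingTo : {n : ℕ} (M : Fin k) (w : Vec (Fin k) (suc n)) → IncreasingToᵛ M w → IncreasingTo M (toList w)
IncreasingToᵛ⇒IncreasingTo {n = zero}  M (x V.∷ V.[])    inc = tt
IncreasingToᵛ⇒IncreasingTo {n = suc n} M (x V.∷ y V.∷ w) inc =
  (λ M∈ → let M∈yw = ∈-toList⁻ M∈ in inc F.zero (F.suc (index M∈yw)) (sym (lookup-index M∈yw)) (s≤s z≤n)) ,
  IncreasingToᵛ⇒IncreasingTo M (y V.∷ w) (λ i p w[p]≡M i<p → inc (F.suc i) (F.suc p) w[p]≡M (s≤s i<p))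

IncreasingTo⇒IncreasingToᵛ : {n : ℕ} (M : Fin k) (w : Vec (Fin k) (suc n)) → IncreasingTo M (toList w) → IncreasingToᵛ M w
IncreasingTo⇒IncreasingToᵛ M (x V.∷ y V.∷ w) (x<y , _)   F.zero    (F.suc p) refl _ = x<y (∈-toList⁺ (∈-lookup p (y V.∷ w)))
IncreasingTo⇒IncreasingToᵛ M (x V.∷ y V.∷ w) (_   , inc) (F.suc i) (F.suc p) w[p]≡M (s≤s i<p) =
  IncreasingTo⇒IncreasingToᵛ M (y V.∷ w) inc i p w[p]≡M i<p

toList-cast : {A : Set} {m n : ℕ} .(eq : m ≡ n) (xs : Vec A m) → toList (cast eq xs) ≡ toList xs
toList-cast {n = zero}  eq V.[]       = refl
toList-cast {n = suc n} eq (x V.∷ xs) = cong (x ∷_) (toList-cast (cong pred eq) xs)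

Ω : {m : ℕ} → Vec (Fin (suc m)) (suc m) → Vec (Fin (suc m)) (suc m)
Ω {m} w = cast (trans (ω-length (suc m) (toList w)) (length-toList w)) (fromList (ω (suc m) (toList w)))

toList-Ω : {m : ℕ} (w : Vec (Fin (suc m)) (suc m)) → toList (Ω w) ≡ ω (suc m) (toList w)
toList-Ω w = trans (toList-cast _ _) (toList∘fromList _)

module _ {m : ℕ} (w : Vec (Fin (suc m)) (suc m)) (w∈Q : InQ w) where

  private
    uniq = proj₁ w∈Q

    length≤ : length (toList w) ≤ suc m
    length≤ = ≤-reflexive (length-toList w)

  Ω-InQ : InQ (Ω w)
  Ω-InQ = subst Unique (sym (toList-Ω w))
            (PermutationₛProperties.Unique-resp-↭ (setoid _) (↭⇒↭ₛ (↭-sym (ω-↭ (suc m) (toList w)))) uniq)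
        , IncreasingTo⇒IncreasingToᵛ (fromℕ m) (Ω w) (subst (IncreasingTo (fromℕ m)) (sym (toList-Ω w))
            (IncreasingTo-ω (suc m) (toList w) length≤ uniq (All.universal ≤fromℕ _)
              (IncreasingToᵛ⇒IncreasingTo (fromℕ m) w (proj₂ w∈Q))))

  Ω-involutive : Ω (Ω w) ≡ w
  Ω-involutive = trans (sym (cast-is-id refl _)) (toList-injective refl _ _ (begin
    toList (Ω (Ω w))                         ≡⟨ toList-Ω (Ω w) ⟩
    ω (suc m) (toList (Ω w))                 ≡⟨ cong (ω (suc m)) (toList-Ω w) ⟩
    ω (suc m) (ω (suc m) (toList w))         ≡⟨ ω-involutive (suc m) (toList w) length≤ uniq ⟩
    toList w                                 ∎))

  des≡asc∘Ω : des w ≡ asc (Ω w)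
  des≡asc∘Ω = begin
    des w                                    ≡⟨ countAdjacent-lookup _ w ⟩
    descents (toList w)                      ≡⟨ sym (ascents-ω (suc m) (toList w) length≤ uniq) ⟩
    ascents (ω (suc m) (toList w))           ≡⟨ cong ascents (sym (toList-Ω w)) ⟩
    ascents (toList (Ω w))                   ≡⟨ sym (countAdjacent-lookup _ (Ω w)) ⟩
    asc (Ω w)                                ∎

theorem2p11 : (m : ℕ) →
    Σ (Vec (Fin (suc m)) (suc m) → Vec (Fin (suc m)) (suc m)) λ Ω →
    Σ (Vec (Fin (suc m)) (suc m) → Vec (Fin (suc m)) (suc m)) λ Ω⁻¹ →
      ((w : Vec (Fin (suc m)) (suc m)) → InQ w →
         InQ (Ω w) × InQ (Ω⁻¹ w) × (Ω⁻¹ (Ω w) ≡ w) × (Ω (Ω⁻¹ w) ≡ w)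
         × (des w ≡ asc (Ω w)))
theorem2p11 m = Ω , Ω , λ w w∈Q →
  Ω-InQ w w∈Q , Ω-InQ w w∈Q , Ω-involutive w w∈Q , Ω-involutive w w∈Q , des≡asc∘Ω w w∈Q
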